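{- Let $k$ and $b$ be positive integers and let $p$ be an odd integer such that $$(2^{k+1}-1)(p^2+p+1) = 2^{k+1}p^2 + 2^b p^2 + 1.$$ Then $p \mid 2^k - 1$. -}

module Defs where

open import Data.Nat using (ℕ; _^_)
open import Data.Integer using (ℤ; +_)

pow2 : ℕ → ℤ
pow2 n = + (2 ^ n)

{-# OPTIONS --safe #-}
-- Expanding the equation with x = 2^k and B = 2^b, the p²-free part rearranges to
--   2 (x - 1) = ((B + 1) p - (2x - 1)) p,
-- so p divides 2 (x - 1); being odd, p is coprime to 2 and hence divides x - 1.
module Submission where

open import Defs
open import Data.Nat using (ℕ; suc; _≥_)
import Data.Nat as ℕ
open import Data.Integer using (ℤ; +_; _+_; _*_; _-_; 1ℤ)
open import Data.Integer.Properties using (+-inverseʳ; +-identityˡ; pos-*)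
open import Data.Integer.Divisibility using (_∣_)
open import Data.Integer.Divisibility.Signed as Signed
  using (divides; ∣-refl; ∣m⇒∣m*n; ∣n⇒∣m*n; ∣m∣n⇒∣m-n; ∣⇒∣ᵤ)
open import Data.Integer.Tactic.RingSolver using (solve-∀)
open import Data.Product using (∃; _,_)
open import Relation.Binary.PropositionalEquality
open ≡-Reasoning

pow2-suc : ∀ k → pow2 (suc k) ≡ + 2 * pow2 k
pow2-suc k = pos-* 2 (2 ℕ.^ k)

twice-pred-expansion : ∀ x B p →
  + 2 * (x - 1ℤ) ≡ (+ 2 * x - 1ℤ) * (p * p + p + 1ℤ)
                   - (+ 2 * x * (p * p) + B * (p * p) + 1ℤ)
                   + ((B + 1ℤ) * p - (+ 2 * x - 1ℤ)) * p
twice-pred-expansion = solve-∀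

equation⇒∣2[x-1] : ∀ x B p →
  (+ 2 * x - 1ℤ) * (p * p + p + 1ℤ) ≡ + 2 * x * (p * p) + B * (p * p) + 1ℤ →
  p Signed.∣ + 2 * (x - 1ℤ)
equation⇒∣2[x-1] x B p eq = divides q (begin
  + 2 * (x - 1ℤ)       ≡⟨ twice-pred-expansion x B p ⟩
  L - R + q * p        ≡⟨ cong (λ l → l - R + q * p) eq ⟩
  R - R + q * p        ≡⟨ cong (_+ q * p) (+-inverseʳ R) ⟩
  + 0 + q * p          ≡⟨ +-identityˡ (q * p) ⟩
  q * p                ∎)
  where
  L = (+ 2 * x - 1ℤ) * (p * p + p + 1ℤ)
  R = + 2 * x * (p * p) + B * (p * p) + 1ℤ
  q = (B + 1ℤ) * p - (+ 2 * x - 1ℤ)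

odd-cancel : ∀ m n → (+ 2 * m + 1ℤ) * n - m * (+ 2 * n) ≡ n
odd-cancel = solve-∀

odd∣2*n⇒∣n : ∀ {p} m n → p ≡ + 2 * m + 1ℤ → p Signed.∣ + 2 * n → p Signed.∣ n
odd∣2*n⇒∣n {p} m n refl p∣2n =
  subst (p Signed.∣_) (odd-cancel m n)
    (∣m∣n⇒∣m-n (∣m⇒∣m*n n ∣-refl) (∣n⇒∣m*n m p∣2n))

lemma10 : (k b : ℕ) → k ≥ 1 → b ≥ 1 → (p : ℤ) → (∃ λ m → p ≡ + 2 * m + 1ℤ)
            → (pow2 (suc k) - 1ℤ) * (p * p + p + 1ℤ)
              ≡ pow2 (suc k) * (p * p) + pow2 b * (p * p) + 1ℤ
            → p ∣ (pow2 k - 1ℤ)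
lemma10 k b _ _ p (m , p-odd) eq =
  ∣⇒∣ᵤ (odd∣2*n⇒∣n m (pow2 k - 1ℤ) p-odd (equation⇒∣2[x-1] (pow2 k) (pow2 b) p eq′))
  where
  eq′ : (+ 2 * pow2 k - 1ℤ) * (p * p + p + 1ℤ)
        ≡ + 2 * pow2 k * (p * p) + pow2 b * (p * p) + 1ℤ
  eq′ = subst (λ A → (A - 1ℤ) * (p * p + p + 1ℤ) ≡ A * (p * p) + pow2 b * (p * p) + 1ℤ)
              (pow2-suc k) eq
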